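{- Let $H$ be a graph in which every vertex has degree exactly $3$. Let $H'$ be obtained from $H$ by subdividing every edge twice (each edge replaced by a path with three edges), and let $D$ be the set of vertices of $H'$ not in $H$. Let $G=(V,E)$ be obtained from $H'$ by adding a new vertex $v^*$ and an edge between $v^*$ and each vertex of $D$. Then for every positive integer $k$, $G$ has $k$ pairwise edge-disjoint cuts of size $3$ if and only if $H'$ has an independent set of size $k$.
   Context: A cut of $G$ is a partition of $V$ into two nonempty sets $A,B$, identified with the set $E_G(A,B)$ of edges with one end in $A$ and the other in $B$; its size is $|E_G(A,B)|$. Cuts are edge-disjoint if their edge sets are pairwise disjoint. -}

module Defs where

open import Data.Nat using (ℕ; zero; suc; _+_; _≤_)
open import Data.Fin using (Fin; zero; suc; _≟_)
open import Data.Bool using (Bool; true; false; if_then_else_; _xor_)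
open import Data.Product using (Σ; ∃; _×_; _,_; proj₁; proj₂)
open import Data.Sum using (_⊎_; inj₁; inj₂)
open import Data.Maybe using (Maybe; just; nothing)
open import Data.List using (List; map; allFin; cartesianProduct)
open import Data.Nat.ListAction using (sum)
open import Relation.Nullary using (¬_; Dec; yes; no)
open import Relation.Nullary.Decidable using (⌊_⌋)
open import Relation.Binary.PropositionalEquality using (_≡_; _≢_)

record SimpleGraph (n m : ℕ) : Set where
  field
    ends      : Fin m → Fin n × Fin n
    loopless  : ∀ e → proj₁ (ends e) ≢ proj₂ (ends e)
    noParallel : ∀ e e' → e ≢ e' →
      ¬ ((proj₁ (ends e) ≡ proj₁ (ends e') × proj₂ (ends e) ≡ proj₂ (ends e'))
         ⊎ (proj₁ (ends e) ≡ proj₂ (ends e') × proj₂ (ends e) ≡ proj₁ (ends e')))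

open SimpleGraph public

countFin : ∀ {m} → (Fin m → Bool) → ℕ
countFin {m} p = sum (map (λ e → if p e then 1 else 0) (allFin m))

degree : ∀ {n m} → SimpleGraph n m → Fin n → ℕ
degree H v = countFin (λ e → ⌊ v ≟ proj₁ (ends H e) ⌋ Data.Bool.∨ ⌊ v ≟ proj₂ (ends H e) ⌋)

Cubic : ∀ {n m} → SimpleGraph n m → Set
Cubic {n} H = ∀ (v : Fin n) → degree H v ≡ 3

-- H' : every edge e = u w of H replaced by the path  u - (e,0) - (e,1) - w.
-- Vertices of H': original vertices (inj₁) and subdivision vertices
-- (inj₂ (e , i)), the latter forming the set D.

VH' : ℕ → ℕ → Set
VH' n m = Fin n ⊎ (Fin m × Fin 2)

InD : ∀ {n m} → VH' n m → Set
InD (inj₁ _) = Data.Empty.⊥ where import Data.Empty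
InD (inj₂ _) = Data.Unit.⊤ where import Data.Unit

EH' : ℕ → Set
EH' m = Fin m × Fin 3

endsH' : ∀ {n m} → SimpleGraph n m → EH' m → VH' n m × VH' n m
endsH' H (e , zero)             = inj₁ (proj₁ (ends H e)) , inj₂ (e , zero)
endsH' H (e , suc zero)         = inj₂ (e , zero) , inj₂ (e , suc zero)
endsH' H (e , suc (suc zero))   = inj₂ (e , suc zero) , inj₁ (proj₂ (ends H e))

AdjH' : ∀ {n m} → SimpleGraph n m → VH' n m → VH' n m → Set
AdjH' H x y = Σ (EH' _) λ f →
  (proj₁ (endsH' H f) ≡ x × proj₂ (endsH' H f) ≡ y) ⊎
  (proj₁ (endsH' H f) ≡ y × proj₂ (endsH' H f) ≡ x)

HasIndependentSet : ∀ {n m} → SimpleGraph n m → ℕ → Set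
HasIndependentSet {n} {m} H k = Σ (Fin k → VH' n m) λ f →
  (∀ i j → f i ≡ f j → i ≡ j) × (∀ i j → ¬ AdjH' H (f i) (f j))

VG : ℕ → ℕ → Set
VG n m = Maybe (VH' n m)

vstar : ∀ {n m} → VG n m
vstar = nothing

EG : ℕ → Set
EG m = Fin m × Fin 5

endsG : ∀ {n m} → SimpleGraph n m → EG m → VG n m × VG n m
endsG H (e , zero)                         = just (inj₁ (proj₁ (ends H e))) , just (inj₂ (e , zero))
endsG H (e , suc zero)                     = just (inj₂ (e , zero)) , just (inj₂ (e , suc zero))
endsG H (e , suc (suc zero))               = just (inj₂ (e , suc zero)) , just (inj₁ (proj₂ (ends H e)))
endsG H (e , suc (suc (suc zero)))         = just (inj₂ (e , zero)) , vstar
endsG H (e , suc (suc (suc (suc zero))))   = just (inj₂ (e , suc zero)) , vstar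

allEG : ∀ m → List (EG m)
allEG m = cartesianProduct (allFin m) (allFin 5)

-- Cuts of G.  A cut is a partition (A , B) of V(G) into nonempty sets,
-- represented by its side function  s : VG → Bool  (A = s⁻¹ true).

IsCut : ∀ {n m} → (VG n m → Bool) → Set
IsCut s = ∃ (λ a → s a ≡ true) × ∃ (λ b → s b ≡ false)

Crosses : ∀ {n m} (H : SimpleGraph n m) → (VG n m → Bool) → EG m → Bool
Crosses H s f = s (proj₁ (endsG H f)) xor s (proj₂ (endsG H f))

cutSize : ∀ {n m} (H : SimpleGraph n m) → (VG n m → Bool) → ℕ
cutSize {m = m} H s = sum (map (λ f → if Crosses H s f then 1 else 0) (allEG m))

HasDisjoint3Cuts : ∀ {n m} → SimpleGraph n m → ℕ → Set
HasDisjoint3Cuts {n} {m} H k = Σ (Fin k → (VG n m → Bool)) λ c →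
  (∀ i → IsCut (c i)) ×
  (∀ i → cutSize H (c i) ≡ 3) ×
  (∀ i j → i ≢ j → ∀ (f : EG m) →
     ¬ (Crosses H (c i) f ≡ true × Crosses H (c j) f ≡ true))

module Submission where

-- Let S be the side of a cut not containing v*. The five edges of G on the path that
-- replaces an edge uw of H cross the cut a number of times depending only on which of
-- u, a, b, w (a, b the subdivision vertices) lie in S: call it the cost of the gadget.
-- If S contains a vertex v of H' (and, when v is a subdivision vertex, no vertex of H),
-- then gadget by gadget the cut costs at least as much as the star cut of v, with
-- equality only where it coincides with that star. Since H is cubic every star cut has
-- size 3, so a cut of size 3 is the star cut of a vertex of H'. Finally, the stars of
-- v and w are edge-disjoint iff v ≠ w and vw is not an edge of H'.

open import Defs
open import Data.Nat using (ℕ; zero; suc; _+_; _≤_; _<_; z≤n; s≤s)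
open import Data.Nat.Properties
  using (+-0-monoid; +-identityʳ; +-mono-≤; +-monoʳ-≤; +-monoˡ-≤; +-cancelˡ-≤; +-cancelʳ-≤;
         ≤-antisym; ≤-trans; ≤-reflexive)
open import Data.Fin using (Fin; zero; suc; _≟_)
open import Data.Fin.Properties using (any?)
open import Data.Bool using (Bool; true; false; if_then_else_; _xor_; _∨_) renaming (_≟_ to _≟ᵇ_)
open import Data.Bool.Properties using (xor-same; xor-identityʳ; ¬-not)
open import Data.Product using (∃; _×_; _,_; proj₁; proj₂; uncurry)
open import Data.Product.Properties using (,-injective)
open import Data.Sum using (_⊎_; inj₁; inj₂)
open import Data.Sum.Properties using (≡-dec)
open import Data.Maybe using (just; nothing)
open import Data.Maybe.Properties using (just-injective)
open import Data.List using (List; []; _∷_; _++_; map; tabulate; allFin; cartesianProduct)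
open import Data.List.Properties using (map-++; map-tabulate; map-∘)
open import Data.Nat.ListAction using (sum)
open import Data.Nat.ListAction.Properties using (sum-++)
open import Algebra.Properties.Monoid.Sum +-0-monoid
  using (sum-syntax; sum-cong-≗; sum-replicate-zero) renaming (sum to ∑)
open import Function.Bundles using (_⇔_; mk⇔; Equivalence)
open import Relation.Nullary using (¬_; Dec; yes; no; does)
open import Relation.Nullary.Decidable using (map′; _×-dec_; dec-true; dec-false; ⌊_⌋)
open import Relation.Nullary.Negation using (contradiction)
open import Relation.Binary.Definitions using (DecidableEquality)
open import Relation.Binary.PropositionalEquality

private variable
  A B : Set
  n m : ℕ

sum-tabulate : (f : Fin m → ℕ) → sum (tabulate f) ≡ ∑ f
sum-tabulate {zero}  f = refl
sum-tabulate {suc m} f = cong (f zero +_) (sum-tabulate (λ i → f (suc i)))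

sum-map-allFin : (f : Fin m → ℕ) → sum (map f (allFin m)) ≡ ∑ f
sum-map-allFin f = trans (cong sum (map-tabulate (λ i → i) f)) (sum-tabulate f)

sum-map-cartesianProduct : (g : A × B → ℕ) (xs : List A) (ys : List B) →
  sum (map g (cartesianProduct xs ys)) ≡ sum (map (λ x → sum (map (λ y → g (x , y)) ys)) xs)
sum-map-cartesianProduct g []       ys = refl
sum-map-cartesianProduct g (x ∷ xs) ys = begin
  sum (map g (map (x ,_) ys ++ cartesianProduct xs ys))
    ≡⟨ cong sum (map-++ g (map (x ,_) ys) _) ⟩
  sum (map g (map (x ,_) ys) ++ map g (cartesianProduct xs ys))
    ≡⟨ sum-++ (map g (map (x ,_) ys)) _ ⟩
  sum (map g (map (x ,_) ys)) + sum (map g (cartesianProduct xs ys))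
    ≡⟨ cong₂ _+_ (cong sum (sym (map-∘ ys))) (sum-map-cartesianProduct g xs ys) ⟩
  sum (map (λ y → g (x , y)) ys) + sum (map (λ x → sum (map (λ y → g (x , y)) ys)) xs) ∎
  where open ≡-Reasoning

∑-mono-≤ : {f g : Fin m → ℕ} → (∀ i → f i ≤ g i) → ∑ f ≤ ∑ g
∑-mono-≤ {zero}  f≤g = z≤n
∑-mono-≤ {suc m} f≤g = +-mono-≤ (f≤g zero) (∑-mono-≤ (λ i → f≤g (suc i)))

∑-squeeze : {f g : Fin m → ℕ} → (∀ i → f i ≤ g i) → ∑ g ≤ ∑ f → ∀ i → f i ≡ g i
∑-squeeze {suc m} {f} {g} f≤g ∑g≤∑f zero =
  ≤-antisym (f≤g zero)
    (+-cancelʳ-≤ _ _ _ (≤-trans ∑g≤∑f (+-monoʳ-≤ (f zero) (∑-mono-≤ (λ i → f≤g (suc i))))))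
∑-squeeze {suc m} {f} {g} f≤g ∑g≤∑f (suc i) =
  ∑-squeeze (λ i → f≤g (suc i)) (+-cancelˡ-≤ (g zero) _ _ (≤-trans ∑g≤∑f (+-monoˡ-≤ _ (f≤g zero)))) i

∑-indicator : (k : ℕ) (i₀ : Fin m) → ∑ (λ i → if does (i₀ ≟ i) then k else 0) ≡ k
∑-indicator {suc m} k zero     = trans (cong (k +_) (sum-replicate-zero m)) (+-identityʳ k)
∑-indicator {suc m} k (suc i₀) = ∑-indicator k i₀

∑-positive : (f : Fin m → ℕ) → 0 < ∑ f → ∃ λ i → 0 < f i
∑-positive {suc m} f 0<∑ with f zero in eq
... | suc _ = zero , subst (0 <_) (sym eq) (s≤s z≤n)
... | zero  = let i , 0<fi = ∑-positive (λ i → f (suc i)) 0<∑ in suc i , 0<fi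

ind : Bool → ℕ
ind b = if b then 1 else 0

xor-cancelʳ : ∀ x y z → (x xor z) xor (y xor z) ≡ x xor y
xor-cancelʳ false false false = refl
xor-cancelʳ false false true  = refl
xor-cancelʳ false true  false = refl
xor-cancelʳ false true  true  = refl
xor-cancelʳ true  false false = refl
xor-cancelʳ true  false true  = refl
xor-cancelʳ true  true  false = refl
xor-cancelʳ true  true  true  = refl

xor-true : ∀ {a b} → a xor b ≡ true → a ≡ true ⊎ b ≡ true
xor-true {true}  _   = inj₁ refl
xor-true {false} b≡t = inj₂ b≡t

-- The sides of u, a, b, w, where the edge uw of H is subdivided by a, b;
-- true means "not on the side of v*".
Gadget : Set
Gadget = Bool × Bool × Bool × Bool

cost : Gadget → ℕ
cost (u , a , b , w) = ind (u xor a) + (ind (a xor b) + (ind (b xor w) + (ind a + ind b)))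

_≼_ : Gadget → Gadget → Set
g₀ ≼ g = cost g₀ ≤ cost g × (cost g ≡ cost g₀ → g ≡ g₀)

≼-empty : ∀ g → (false , false , false , false) ≼ g
≼-empty g = z≤n , only g
  where
  only : ∀ g → cost g ≡ 0 → g ≡ (false , false , false , false)
  only (false , false , false , false) _ = refl
  only (true  , false , _     , _    ) ()
  only (false , true  , _     , _    ) ()
  only (true  , true  , false , _    ) ()
  only (true  , true  , true  , false) ()
  only (true  , true  , true  , true ) ()
  only (false , false , true  , _    ) ()
  only (false , false , false , true ) ()

≼-left : ∀ a b w → (true , false , false , false) ≼ (true , a , b , w)
≼-left false false false = s≤s z≤n , λ _ → refl
≼-left false false true  = s≤s z≤n , λ ()
≼-left false true  false = s≤s z≤n , λ ()
≼-left false true  true  = s≤s z≤n , λ ()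
≼-left true  false false = s≤s z≤n , λ ()
≼-left true  false true  = s≤s z≤n , λ ()
≼-left true  true  false = s≤s z≤n , λ ()
≼-left true  true  true  = s≤s z≤n , λ ()

≼-right : ∀ u a b → (false , false , false , true) ≼ (u , a , b , true)
≼-right false false false = s≤s z≤n , λ _ → refl
≼-right false false true  = s≤s z≤n , λ ()
≼-right false true  false = s≤s z≤n , λ ()
≼-right false true  true  = s≤s z≤n , λ ()
≼-right true  false false = s≤s z≤n , λ ()
≼-right true  false true  = s≤s z≤n , λ ()
≼-right true  true  false = s≤s z≤n , λ ()
≼-right true  true  true  = s≤s z≤n , λ ()

≼-first-middle : ∀ b → (false , true , false , false) ≼ (false , true , b , false)
≼-first-middle false = s≤s (s≤s (s≤s z≤n)) , λ _ → refl
≼-first-middle true  = s≤s (s≤s (s≤s z≤n)) , λ ()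

≼-second-middle : ∀ a → (false , false , true , false) ≼ (false , a , true , false)
≼-second-middle false = s≤s (s≤s (s≤s z≤n)) , λ _ → refl
≼-second-middle true  = s≤s (s≤s (s≤s z≤n)) , λ ()

≼-squeeze : (f g : Fin m → Gadget) → (∀ e → f e ≼ g e) →
  ∑[ e < m ] cost (g e) ≤ ∑[ e < m ] cost (f e) → ∀ e → g e ≡ f e
≼-squeeze f g f≼g ∑≤ e = proj₂ (f≼g e) (sym (∑-squeeze (λ e → proj₁ (f≼g e)) ∑≤ e))

-- Decided componentwise, not by Data.Product.Properties.≡-dec, so that
-- membership in a star reduces to comparisons of edges and positions.
_≟ᵛ_ : DecidableEquality (VH' n m)
_≟ᵛ_ = ≡-dec _≟_ λ (e , i) (f , j) → map′ (uncurry (cong₂ _,_)) ,-injective ((e ≟ f) ×-dec (i ≟ j))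

star : VH' n m → VG n m → Bool
star v nothing  = false
star v (just y) = does (v ≟ᵛ y)

side : (VG n m → Bool) → VG n m → Bool
side s x = s x xor s vstar

side-vstar : (s : VG n m → Bool) → side s vstar ≡ false
side-vstar s = xor-same (s vstar)

side-star : (v : VH' n m) → side (star v) ≗ star v
side-star v x = xor-identityʳ (star v x)

star-self : (v : VH' n m) → star v (just v) ≡ true
star-self v = dec-true (v ≟ᵛ v) refl

star-true : (v : VH' n m) {x : VG n m} → star v x ≡ true → x ≡ just v
star-true v {just y} v∈ with v ≟ᵛ y
... | yes refl = refl

star-false : (v : VH' n m) {x : VG n m} → x ≢ just v → star v x ≡ false
star-false v {nothing} _   = refl
star-false v {just y}  x≢v = dec-false (v ≟ᵛ y) λ v≡y → x≢v (cong just (sym v≡y))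

star-isCut : (v : VH' n m) → IsCut (star v)
star-isCut v = (just v , star-self v) , (nothing , refl)

separated : {s : VG n m → Bool} → IsCut s → ∃ λ x → side s x ≡ true
separated {s = s} ((a , sa) , (b , sb)) with s vstar
... | true  = b , cong (_xor true) sb
... | false = a , cong (_xor false) sa

separated-vertex : {s : VG n m → Bool} → IsCut s → ∃ λ y → side s (just y) ≡ true
separated-vertex {s = s} cut with separated cut
... | just y  , σy = y , σy
... | nothing , σ* = contradiction (trans (sym (side-vstar s)) σ*) λ ()

module _ {n m : ℕ} (H : SimpleGraph n m) where

  gadget : (VG n m → Bool) → Fin m → Gadget
  gadget σ e =
    σ (just (inj₁ (proj₁ (ends H e)))) , σ (just (inj₂ (e , zero))) ,
    σ (just (inj₂ (e , suc zero)))     , σ (just (inj₁ (proj₂ (ends H e))))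

  gadget-cong : {σ τ : VG n m → Bool} → σ ≗ τ → ∀ e → gadget σ e ≡ gadget τ e
  gadget-cong σ≗τ e = cong₂ _,_ (σ≗τ _) (cong₂ _,_ (σ≗τ _) (cong₂ _,_ (σ≗τ _) (σ≗τ _)))

  gadget-crossings : (s : VG n m → Bool) (e : Fin m) →
    sum (map (λ i → ind (Crosses H s (e , i))) (allFin 5)) ≡ cost (gadget (side s) e)
  gadget-crossings s e =
    crossings (s vstar) (s (just (inj₁ (proj₁ (ends H e))))) (s (just (inj₂ (e , zero))))
              (s (just (inj₂ (e , suc zero)))) (s (just (inj₁ (proj₂ (ends H e)))))
    where
    crossings : ∀ t u a b w →
      ind (u xor a) + (ind (a xor b) + (ind (b xor w) + (ind (a xor t) + (ind (b xor t) + 0)))) ≡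
      cost (u xor t , a xor t , b xor t , w xor t)
    crossings t u a b w rewrite xor-cancelʳ u a t | xor-cancelʳ a b t | xor-cancelʳ b w t =
      cong (λ k → ind (u xor a) + (ind (a xor b) + (ind (b xor w) + (ind (a xor t) + k)))) (+-identityʳ _)

  cutSize-gadgets : (s : VG n m → Bool) → cutSize H s ≡ ∑[ e < m ] cost (gadget (side s) e)
  cutSize-gadgets s = begin
    cutSize H s
      ≡⟨ sum-map-cartesianProduct (λ f → ind (Crosses H s f)) (allFin m) (allFin 5) ⟩
    sum (map crossings (allFin m))
      ≡⟨ sum-map-allFin crossings ⟩
    ∑ crossings
      ≡⟨ sum-cong-≗ (gadget-crossings s) ⟩
    ∑[ e < m ] cost (gadget (side s) e) ∎
    where
    open ≡-Reasoning
    crossings : Fin m → ℕ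
    crossings e = sum (map (λ i → ind (Crosses H s (e , i))) (allFin 5))

  cost-star-inj₁ : ∀ x e →
    cost (gadget (star (inj₁ x)) e) ≡ ind (⌊ x ≟ proj₁ (ends H e) ⌋ ∨ ⌊ x ≟ proj₂ (ends H e) ⌋)
  cost-star-inj₁ x e with x ≟ proj₁ (ends H e) | x ≟ proj₂ (ends H e)
  ... | yes x≡p | yes x≡q = contradiction (trans (sym x≡p) x≡q) (loopless H e)
  ... | yes _   | no _    = refl
  ... | no _    | yes _   = refl
  ... | no _    | no _    = refl

  cost-star-inj₂ : ∀ e₀ i e → cost (gadget (star (inj₂ (e₀ , i))) e) ≡ (if does (e₀ ≟ e) then 3 else 0)
  cost-star-inj₂ e₀ i e with e₀ ≟ e
  cost-star-inj₂ e₀ zero       e | yes _ = refl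
  cost-star-inj₂ e₀ (suc zero) e | yes _ = refl
  ... | no _ = refl

  star-inj₁-≼ : ∀ {σ} x → σ (just (inj₁ x)) ≡ true → ∀ e → gadget (star (inj₁ x)) e ≼ gadget σ e
  star-inj₁-≼ x σx e with x ≟ proj₁ (ends H e) | x ≟ proj₂ (ends H e)
  ... | yes x≡p  | yes x≡q  = contradiction (trans (sym x≡p) x≡q) (loopless H e)
  ... | yes refl | no _     rewrite σx = ≼-left _ _ _
  ... | no _     | yes refl rewrite σx = ≼-right _ _ _
  ... | no _     | no _     = ≼-empty _

  star-inj₂-≼ : ∀ {σ} e₀ i → σ (just (inj₂ (e₀ , i))) ≡ true → (∀ x → σ (just (inj₁ x)) ≡ false) →
    ∀ e → gadget (star (inj₂ (e₀ , i))) e ≼ gadget σ e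
  star-inj₂-≼ e₀ i σv ends-false e
    rewrite ends-false (proj₁ (ends H e)) | ends-false (proj₂ (ends H e)) with e₀ ≟ e
  star-inj₂-≼ e₀ zero       σv _ e | yes refl rewrite σv = ≼-first-middle _
  star-inj₂-≼ e₀ (suc zero) σv _ e | yes refl rewrite σv = ≼-second-middle _
  ... | no _ = ≼-empty _

  Crosses-side : ∀ s g → Crosses H (side s) g ≡ Crosses H s g
  Crosses-side s g = xor-cancelʳ (s (proj₁ (endsG H g))) (s (proj₂ (endsG H g))) (s vstar)

  Crosses-cong : ∀ {s s′} → s ≗ s′ → ∀ g → Crosses H s g ≡ Crosses H s′ g
  Crosses-cong s≗s′ g = cong₂ _xor_ (s≗s′ _) (s≗s′ _)

  endsG-distinct : ∀ g → proj₁ (endsG H g) ≢ proj₂ (endsG H g)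
  endsG-distinct (e , zero)                       ()
  endsG-distinct (e , suc zero)                   ()
  endsG-distinct (e , suc (suc zero))             ()
  endsG-distinct (e , suc (suc (suc zero)))       ()
  endsG-distinct (e , suc (suc (suc (suc zero)))) ()

  IsEndOf : VH' n m → EG m → Set
  IsEndOf v g = proj₁ (endsG H g) ≡ just v ⊎ proj₂ (endsG H g) ≡ just v

  crosses-star⇒end : ∀ v g → Crosses H (star v) g ≡ true → IsEndOf v g
  crosses-star⇒end v g c with xor-true c
  ... | inj₁ v₁ = inj₁ (star-true v v₁)
  ... | inj₂ v₂ = inj₂ (star-true v v₂)

  end⇒crosses-star : ∀ v g → IsEndOf v g → Crosses H (star v) g ≡ true
  end⇒crosses-star v g (inj₁ e₁≡v) =
    cong₂ _xor_ (trans (cong (star v) e₁≡v) (star-self v))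
                (star-false v λ e₂≡v → endsG-distinct g (trans e₁≡v (sym e₂≡v)))
  end⇒crosses-star v g (inj₂ e₂≡v) =
    cong₂ _xor_ (star-false v λ e₁≡v → endsG-distinct g (trans e₁≡v (sym e₂≡v)))
                (trans (cong (star v) e₂≡v) (star-self v))

  H'-edge-in-G : ∀ f → ∃ λ g →
    proj₁ (endsG H g) ≡ just (proj₁ (endsH' H f)) × proj₂ (endsG H g) ≡ just (proj₂ (endsH' H f))
  H'-edge-in-G (e , zero)           = (e , zero) , refl , refl
  H'-edge-in-G (e , suc zero)       = (e , suc zero) , refl , refl
  H'-edge-in-G (e , suc (suc zero)) = (e , suc (suc zero)) , refl , refl

  joined-in-H' : ∀ g {x y} → proj₁ (endsG H g) ≡ just x → proj₂ (endsG H g) ≡ just y → AdjH' H x y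
  joined-in-H' (e , zero)                       refl refl = (e , zero) , inj₁ (refl , refl)
  joined-in-H' (e , suc zero)                   refl refl = (e , suc zero) , inj₁ (refl , refl)
  joined-in-H' (e , suc (suc zero))             refl refl = (e , suc (suc zero)) , inj₁ (refl , refl)
  joined-in-H' (e , suc (suc (suc zero)))       _    ()
  joined-in-H' (e , suc (suc (suc (suc zero)))) _    ()

  AdjH'-sym : ∀ {x y} → AdjH' H x y → AdjH' H y x
  AdjH'-sym (f , inj₁ ends) = f , inj₂ ends
  AdjH'-sym (f , inj₂ ends) = f , inj₁ ends

  AdjH'-irrefl : ∀ {x} → ¬ AdjH' H x x
  AdjH'-irrefl (f , ends) with H'-edge-in-G f
  ... | g , e₁ , e₂ = endsG-distinct g (trans e₁ (trans (cong just (loop ends)) (sym e₂)))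
    where
    loop : ∀ {x} → (proj₁ (endsH' H f) ≡ x × proj₂ (endsH' H f) ≡ x) ⊎
                   (proj₁ (endsH' H f) ≡ x × proj₂ (endsH' H f) ≡ x) →
           proj₁ (endsH' H f) ≡ proj₂ (endsH' H f)
    loop (inj₁ (p , q)) = trans p (sym q)
    loop (inj₂ (p , q)) = trans p (sym q)

  adjacent-stars-share-edge : ∀ {v w} → AdjH' H v w →
    ∃ λ g → Crosses H (star v) g ≡ true × Crosses H (star w) g ≡ true
  adjacent-stars-share-edge (f , inj₁ (refl , refl)) with H'-edge-in-G f
  ... | g , e₁ , e₂ = g , end⇒crosses-star _ g (inj₁ e₁) , end⇒crosses-star _ g (inj₂ e₂)
  adjacent-stars-share-edge (f , inj₂ (refl , refl)) with H'-edge-in-G f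
  ... | g , e₁ , e₂ = g , end⇒crosses-star _ g (inj₂ e₂) , end⇒crosses-star _ g (inj₁ e₁)

  EdgeDisjoint : (VG n m → Bool) → (VG n m → Bool) → Set
  EdgeDisjoint s s′ = ∀ g → ¬ (Crosses H s g ≡ true × Crosses H s′ g ≡ true)

  module _ (cubic : Cubic H) where

    incident-edge : ∀ x → ∃ λ e → x ≡ proj₁ (ends H e) ⊎ x ≡ proj₂ (ends H e)
    incident-edge x
      with ∑-positive _ (subst (0 <_) (trans (sym (cubic x)) (sum-map-allFin {m = m} _)) (s≤s z≤n))
    ... | e , 0<deg with x ≟ proj₁ (ends H e) | x ≟ proj₂ (ends H e)
    ...   | yes x≡p | _       = e , inj₁ x≡p
    ...   | no _    | yes x≡q = e , inj₂ x≡q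
    ...   | no _    | no _    = contradiction 0<deg λ ()

    incident-G-edge : ∀ v → ∃ (IsEndOf v)
    incident-G-edge (inj₂ (e , zero))     = (e , suc (suc (suc zero))) , inj₁ refl
    incident-G-edge (inj₂ (e , suc zero)) = (e , suc (suc (suc (suc zero)))) , inj₁ refl
    incident-G-edge (inj₁ x) with incident-edge x
    ... | e , inj₁ refl = (e , zero) , inj₁ refl
    ... | e , inj₂ refl = (e , suc (suc zero)) , inj₂ refl

    star-cost : ∀ v → ∑[ e < m ] cost (gadget (star v) e) ≡ 3
    star-cost (inj₁ x) = begin
      ∑[ e < m ] cost (gadget (star (inj₁ x)) e)
        ≡⟨ sum-cong-≗ (cost-star-inj₁ x) ⟩
      ∑[ e < m ] ind (⌊ x ≟ proj₁ (ends H e) ⌋ ∨ ⌊ x ≟ proj₂ (ends H e) ⌋)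
        ≡⟨ sum-map-allFin {m = m} _ ⟨
      degree H x
        ≡⟨ cubic x ⟩
      3 ∎
      where open ≡-Reasoning
    star-cost (inj₂ (e₀ , i)) = trans (sum-cong-≗ (cost-star-inj₂ e₀ i)) (∑-indicator 3 e₀)

    star-cutSize : ∀ v → cutSize H (star v) ≡ 3
    star-cutSize v = begin
      cutSize H (star v)                           ≡⟨ cutSize-gadgets (star v) ⟩
      ∑[ e < m ] cost (gadget (side (star v)) e)  ≡⟨ sum-cong-≗ (λ e → cong cost (gadget-cong (side-star v) e)) ⟩
      ∑[ e < m ] cost (gadget (star v) e)         ≡⟨ star-cost v ⟩
      3 ∎
      where open ≡-Reasoning

    agree-on-gadgets : {σ τ : VG n m → Bool} → (∀ e → gadget σ e ≡ gadget τ e) →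
      ∀ y → σ (just y) ≡ τ (just y)
    agree-on-gadgets same (inj₂ (e , zero))     = cong (λ g → proj₁ (proj₂ g)) (same e)
    agree-on-gadgets same (inj₂ (e , suc zero)) = cong (λ g → proj₁ (proj₂ (proj₂ g))) (same e)
    agree-on-gadgets same (inj₁ x) with incident-edge x
    ... | e , inj₁ refl = cong proj₁ (same e)
    ... | e , inj₂ refl = cong (λ g → proj₂ (proj₂ (proj₂ g))) (same e)

    dominated-star : ∀ {σ} v → σ vstar ≡ false → ∑[ e < m ] cost (gadget σ e) ≤ 3 →
      (∀ e → gadget (star v) e ≼ gadget σ e) → σ ≗ star v
    dominated-star v σ* ∑≤3 dominated nothing = σ*
    dominated-star {σ} v σ* ∑≤3 dominated (just y) =
      agree-on-gadgets {σ} {star v} (≼-squeeze (gadget (star v)) (gadget σ) dominated ∑≤∑star) y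
      where
      ∑≤∑star : ∑[ e < m ] cost (gadget σ e) ≤ ∑[ e < m ] cost (gadget (star v) e)
      ∑≤∑star = subst (_ ≤_) (sym (star-cost v)) ∑≤3

    three-cut-is-star : ∀ {s} → IsCut s → cutSize H s ≡ 3 → ∃ λ v → side s ≗ star v
    three-cut-is-star {s} cut size≡3 = star-of (any? λ x → side s (just (inj₁ x)) ≟ᵇ true)
      where
      ∑≤3 : ∑[ e < m ] cost (gadget (side s) e) ≤ 3
      ∑≤3 = ≤-reflexive (trans (sym (cutSize-gadgets s)) size≡3)

      star-of : Dec (∃ λ x → side s (just (inj₁ x)) ≡ true) → ∃ λ v → side s ≗ star v
      star-of (yes (x , σx)) =
        inj₁ x , dominated-star {side s} _ (side-vstar {n = n} s) ∑≤3 (star-inj₁-≼ {side s} x σx)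
      star-of (no no-end) with separated-vertex cut
      ... | inj₁ x , σx = contradiction (x , σx) no-end
      ... | inj₂ (e₀ , i) , σv =
        inj₂ (e₀ , i) , dominated-star {side s} _ (side-vstar {n = n} s) ∑≤3
          (star-inj₂-≼ {side s} e₀ i σv λ x → ¬-not λ σx → no-end (x , σx))

    stars-disjoint⇔ : ∀ v w → EdgeDisjoint (star v) (star w) ⇔ (v ≢ w × ¬ AdjH' H v w)
    stars-disjoint⇔ v w = mk⇔ apart disjoint
      where
      apart : EdgeDisjoint (star v) (star w) → v ≢ w × ¬ AdjH' H v w
      apart disj =
        (λ { refl → let g , v∈g = incident-G-edge v ; c = end⇒crosses-star v g v∈g in disj g (c , c) }) ,
        λ adj → let g , cs = adjacent-stars-share-edge adj in disj g cs

      disjoint : v ≢ w × ¬ AdjH' H v w → EdgeDisjoint (star v) (star w)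
      disjoint (v≢w , ¬adj) g (cv , cw) with crosses-star⇒end v g cv | crosses-star⇒end w g cw
      ... | inj₁ p | inj₁ q = v≢w (just-injective (trans (sym p) q))
      ... | inj₂ p | inj₂ q = v≢w (just-injective (trans (sym p) q))
      ... | inj₁ p | inj₂ q = ¬adj (joined-in-H' g p q)
      ... | inj₂ p | inj₁ q = ¬adj (AdjH'-sym (joined-in-H' g q p))

    independent-set-of-cuts : ∀ k → HasDisjoint3Cuts H k → HasIndependentSet H k
    independent-set-of-cuts k (c , cuts , sizes , disjoint) = v , injective , independent
      where
      v : Fin k → VH' n m
      v i = proj₁ (three-cut-is-star (cuts i) (sizes i))

      crosses-as-star : ∀ i g → Crosses H (c i) g ≡ Crosses H (star (v i)) g
      crosses-as-star i g =
        trans (sym (Crosses-side (c i) g)) (Crosses-cong (proj₂ (three-cut-is-star (cuts i) (sizes i))) g)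

      apart : ∀ {i j} → i ≢ j → v i ≢ v j × ¬ AdjH' H (v i) (v j)
      apart {i} {j} i≢j = Equivalence.to (stars-disjoint⇔ (v i) (v j)) λ g →
        subst₂ (λ ci cj → ¬ (ci ≡ true × cj ≡ true)) (crosses-as-star i g) (crosses-as-star j g)
          (disjoint i j i≢j g)

      injective : ∀ i j → v i ≡ v j → i ≡ j
      injective i j vi≡vj with i ≟ j
      ... | yes i≡j = i≡j
      ... | no  i≢j = contradiction vi≡vj (proj₁ (apart i≢j))

      independent : ∀ i j → ¬ AdjH' H (v i) (v j)
      independent i j with i ≟ j
      ... | yes refl = AdjH'-irrefl
      ... | no  i≢j  = proj₂ (apart i≢j)

    cuts-of-independent-set : ∀ k → HasIndependentSet H k → HasDisjoint3Cuts H k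
    cuts-of-independent-set k (v , injective , independent) =
      (λ i → star (v i)) , (λ i → star-isCut (v i)) , (λ i → star-cutSize (v i)) ,
      λ i j i≢j → Equivalence.from (stars-disjoint⇔ (v i) (v j))
                    ((λ vi≡vj → i≢j (injective i j vi≡vj)) , independent i j)

lemma6 : ∀ {n m} (H : SimpleGraph n m) → Cubic H →
    ∀ (k : ℕ) → 1 ≤ k → (HasDisjoint3Cuts H k ⇔ HasIndependentSet H k)
lemma6 H cubic k _ = mk⇔ (independent-set-of-cuts H cubic k) (cuts-of-independent-set H cubic k)
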